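{- Let $n \ge 4$ and $r,s \in \{0,1,\ldots,n-3\}$, and let $G$ be either $G_{n,r,s}$ or $G_{n,r,s}^+$. Then $G$ is $3$-connected if and only if either (i) $r=1$, $s=n-3$, and $G = G^+_{n,r,s}$ (the plus edge is present), or symmetrically $s=1$, $r=n-3$, and $G = G^+_{n,r,s}$; or (ii) $r,s \ge 2$ and $r+s \ge n-2$.
   Context: All graphs are simple. For $n \ge 3$ and $r,s \in \{0,1,\ldots,n-3\}$, the graph $G_{n,r,s}$ has vertex set $\{v_1,\ldots,v_n\}$ and consists of the path $v_1v_2\ldots v_n$ (the spine), the edges $v_1v_{n-i}$ for $1 \le i \le r$, and the edges $v_nv_{1+j}$ for $1 \le j \le s$. The graph $G^+_{n,r,s}$ is $G_{n,r,s}$ together with the edge $v_1v_n$ (the plus edge). -}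

module Defs where

open import Data.Nat using (ℕ; zero; suc; _+_; _∸_; _≤_; _<_)
open import Data.Bool using (Bool; true; false)
open import Data.Fin using (Fin; toℕ)
open import Data.Fin.Subset using (Subset; _∉_; ∣_∣)
open import Data.Product using (_×_)
open import Data.Sum using (_⊎_)
open import Relation.Binary.PropositionalEquality using (_≡_)
open import Relation.Binary.Construct.Closure.ReflexiveTransitive using (Star)

-- Vertices are labelled 1..n as in the paper (label a stands for v_a).
-- GEdge n r s plus a b : {v_a, v_b} is an edge of G_{n,r,s} (plus = false)
-- or of G^+_{n,r,s} (plus = true), listed in one orientation.
data GEdge (n r s : ℕ) (plus : Bool) : ℕ → ℕ → Set where
  spine : ∀ {i} → 1 ≤ i → suc i ≤ n → GEdge n r s plus i (suc i)
  left  : ∀ {i} → 1 ≤ i → i ≤ r → GEdge n r s plus 1 (n ∸ i)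
  right : ∀ {j} → 1 ≤ j → j ≤ s → GEdge n r s plus n (suc j)
  plusE : plus ≡ true → GEdge n r s plus 1 n

-- Adjacency in the graph on vertex set Fin n (vertex x is v_{toℕ x + 1}),
-- symmetric closure of GEdge.
Adj : (n r s : ℕ) (plus : Bool) → Fin n → Fin n → Set
Adj n r s plus x y =
  GEdge n r s plus (suc (toℕ x)) (suc (toℕ y)) ⊎ GEdge n r s plus (suc (toℕ y)) (suc (toℕ x))

ConnectedAvoiding : {n : ℕ} → (Fin n → Fin n → Set) → Subset n → Set
ConnectedAvoiding {n} A S =
  ∀ (u v : Fin n) → u ∉ S → v ∉ S →
    Star (λ x y → A x y × (x ∉ S × y ∉ S)) u v

KConnected : (k : ℕ) {n : ℕ} → (Fin n → Fin n → Set) → Set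
KConnected k {n} A = k < n × (∀ (S : Subset n) → ∣ S ∣ < k → ConnectedAvoiding A S)

-- A vertex cut of size at most two is a pair of labels (a missing vertex is given the
-- non-label 0), so everything happens on the labelled path v_1 ... v_n.
--
-- Sufficiency: after deleting two vertices there is a hub every remaining vertex walks to.
-- If v_1 and v_n both survive, every vertex other than them is adjacent to v_1 (labels
-- at least n-r) or to v_n (labels at most s+1) because r + s >= n - 2, and v_n reaches
-- v_1 either along the plus edge or, when r, s >= 2, along one of the three internally
-- disjoint paths n,2,1 and n,n-1,1 and n,3,...,n-2,1. If exactly one of v_1, v_n is
-- deleted, the other is the hub, reached by a jump along a chord after a spine segment
-- that avoids the second deleted vertex; if both are deleted the spine from v_2 to
-- v_{n-1} is intact.
--
-- Necessity: v_1 is isolated by {v_2, v_n} when r = 0 and by {v_2, v_{n-1}} when r = 1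
-- and the plus edge is absent (symmetrically for v_n), and when r + s < n - 2 the spine
-- vertices strictly between v_{s+1} and v_{n-r} carry no chord, so these two vertices
-- separate them from v_1.

module Submission where

open import Data.Bool using (Bool; true; false)
import Data.Bool as Bool
open import Data.Fin using (Fin; zero; suc; toℕ)
open import Data.Fin.Properties using (toℕ<n; toℕ-fromℕ<; toℕ-injective)
open import Data.Fin.Subset using (Subset; _∈_; _∉_; ∣_∣; ⁅_⁆; ⊥; _∪_)
open import Data.Fin.Subset.Properties
  using (∣⁅x⁆∣≡1; ∣⊥∣≡0; ∪-identityˡ; x∈⁅x⁆; x∈⁅y⁆⇒x≡y; ∉⊥; x∈p∪q⁺; x∈p∪q⁻)
open import Data.Maybe using (Maybe; just; nothing; maybe′; map)
open import Data.Nat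
  using (ℕ; suc; _+_; _∸_; _≤_; _<_; _≤′_; ≤′-refl; ≤′-step; _%_; _≟_; _≤?_; _<?_; z≤n; s≤s; NonZero; >-nonZero)
open import Data.Nat.DivMod using (_mod_; m<n⇒m%n≡m)
open import Data.Nat.Properties
open import Data.Product using (_×_; _,_; proj₂; ∃; ∃₂; Σ-syntax)
open import Data.Sum using (_⊎_; inj₁; inj₂; swap; [_,_]′)
open import Data.Vec using ([]; _∷_)
open import Function using (_∘_)
open import Function.Bundles using (_⇔_; mk⇔; Equivalence)
open import Relation.Binary.Construct.Closure.ReflexiveTransitive using (Star; ε; _◅_; _◅◅_; reverse)
import Relation.Binary.Construct.Closure.ReflexiveTransitive as Star
open import Relation.Binary.PropositionalEquality
  using (_≡_; _≢_; refl; sym; trans; cong; cong₂; subst; subst₂; ≢-sym; module ≡-Reasoning)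
open import Relation.Nullary using (¬_; Dec; yes; no; contradiction)
open import Relation.Nullary.Decidable using (_×-dec_; ¬?; decidable-stable)

open import Defs

⁅_⁆′ : ∀ {n} → Maybe (Fin n) → Subset n
⁅_⁆′ = maybe′ ⁅_⁆ ⊥

⁅map-suc⁆′ : ∀ {n} (x : Maybe (Fin n)) → ⁅ map suc x ⁆′ ≡ false ∷ ⁅ x ⁆′
⁅map-suc⁆′ (just x) = refl
⁅map-suc⁆′ nothing  = refl

∣⁅x⁆′∣≤1 : ∀ {n} (x : Maybe (Fin n)) → ∣ ⁅ x ⁆′ ∣ ≤ 1
∣⁅x⁆′∣≤1     (just x) = ≤-reflexive (∣⁅x⁆∣≡1 x)
∣⁅x⁆′∣≤1 {n} nothing  = ≤-trans (≤-reflexive (∣⊥∣≡0 n)) z≤n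

∣p∪q∣≤∣p∣+∣q∣ : ∀ {n} (p q : Subset n) → ∣ p ∪ q ∣ ≤ ∣ p ∣ + ∣ q ∣
∣p∪q∣≤∣p∣+∣q∣ []          []          = z≤n
∣p∪q∣≤∣p∣+∣q∣ (true ∷ p)  (true ∷ q)  =
  s≤s (≤-trans (m≤n⇒m≤1+n (∣p∪q∣≤∣p∣+∣q∣ p q)) (≤-reflexive (sym (+-suc ∣ p ∣ ∣ q ∣))))
∣p∪q∣≤∣p∣+∣q∣ (true ∷ p)  (false ∷ q) = s≤s (∣p∪q∣≤∣p∣+∣q∣ p q)
∣p∪q∣≤∣p∣+∣q∣ (false ∷ p) (true ∷ q)  =
  ≤-trans (s≤s (∣p∪q∣≤∣p∣+∣q∣ p q)) (≤-reflexive (sym (+-suc ∣ p ∣ ∣ q ∣)))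
∣p∪q∣≤∣p∣+∣q∣ (false ∷ p) (false ∷ q) = ∣p∪q∣≤∣p∣+∣q∣ p q

∣p∣≤0⇒p≡⊥ : ∀ {n} (p : Subset n) → ∣ p ∣ ≤ 0 → p ≡ ⊥
∣p∣≤0⇒p≡⊥ []          _     = refl
∣p∣≤0⇒p≡⊥ (false ∷ p) ∣p∣≤0 = cong (false ∷_) (∣p∣≤0⇒p≡⊥ p ∣p∣≤0)

∣p∣≤1⇒p≡⁅x⁆′ : ∀ {n} (p : Subset n) → ∣ p ∣ ≤ 1 → ∃ λ x → p ≡ ⁅ x ⁆′
∣p∣≤1⇒p≡⁅x⁆′ []          _            = nothing , refl
∣p∣≤1⇒p≡⁅x⁆′ (true ∷ p)  (s≤s ∣p∣≤0) = just zero , cong (true ∷_) (∣p∣≤0⇒p≡⊥ p ∣p∣≤0)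
∣p∣≤1⇒p≡⁅x⁆′ (false ∷ p) ∣p∣≤1 with ∣p∣≤1⇒p≡⁅x⁆′ p ∣p∣≤1
... | x , refl = map suc x , sym (⁅map-suc⁆′ x)

∣p∣≤2⇒p≡⁅x⁆′∪⁅y⁆′ : ∀ {n} (p : Subset n) → ∣ p ∣ ≤ 2 → ∃₂ λ x y → p ≡ ⁅ x ⁆′ ∪ ⁅ y ⁆′
∣p∣≤2⇒p≡⁅x⁆′∪⁅y⁆′ []          _            = nothing , nothing , refl
∣p∣≤2⇒p≡⁅x⁆′∪⁅y⁆′ (true ∷ p)  (s≤s ∣p∣≤1) with ∣p∣≤1⇒p≡⁅x⁆′ p ∣p∣≤1
... | y , refl = just zero , map suc y , sym (begin
  ⁅ just zero ⁆′ ∪ ⁅ map suc y ⁆′    ≡⟨ cong (⁅ just zero ⁆′ ∪_) (⁅map-suc⁆′ y) ⟩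
  ⁅ just zero ⁆′ ∪ (false ∷ ⁅ y ⁆′)  ≡⟨ cong (true ∷_) (∪-identityˡ ⁅ y ⁆′) ⟩
  true ∷ ⁅ y ⁆′                      ∎)
  where open ≡-Reasoning
∣p∣≤2⇒p≡⁅x⁆′∪⁅y⁆′ (false ∷ p) ∣p∣≤2 with ∣p∣≤2⇒p≡⁅x⁆′∪⁅y⁆′ p ∣p∣≤2
... | x , y , refl = map suc x , map suc y , sym (cong₂ _∪_ (⁅map-suc⁆′ x) (⁅map-suc⁆′ y))

KConnected3⇔ : ∀ {n} (A : Fin n → Fin n → Set) →
  KConnected 3 A ⇔ (3 < n × ∀ x y → ConnectedAvoiding A (⁅ x ⁆′ ∪ ⁅ y ⁆′))
KConnected3⇔ A = mk⇔
  (λ (3<n , connected) → 3<n , λ x y → connected (⁅ x ⁆′ ∪ ⁅ y ⁆′) (s≤s (∣⁅x⁆′∪⁅y⁆′∣≤2 x y)))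
  (λ (3<n , connected) → 3<n , λ S ∣S∣<3 →
    let x , y , S≡ = ∣p∣≤2⇒p≡⁅x⁆′∪⁅y⁆′ S (≤-pred ∣S∣<3) in
    subst (ConnectedAvoiding A) (sym S≡) (connected x y))
  where
  ∣⁅x⁆′∪⁅y⁆′∣≤2 : ∀ x y → ∣ ⁅ x ⁆′ ∪ ⁅ y ⁆′ ∣ ≤ 2
  ∣⁅x⁆′∪⁅y⁆′∣≤2 x y = ≤-trans (∣p∪q∣≤∣p∣+∣q∣ ⁅ x ⁆′ ⁅ y ⁆′) (+-mono-≤ (∣⁅x⁆′∣≤1 x) (∣⁅x⁆′∣≤1 y))

Admissible : ℕ → ℕ → ℕ → Bool → Set
Admissible n r s plus =
  ((r ≡ 1 × s ≡ n ∸ 3 × plus ≡ true) ⊎ (s ≡ 1 × r ≡ n ∸ 3 × plus ≡ true)) ⊎ (2 ≤ r × 2 ≤ s × n ∸ 2 ≤ r + s)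

Sufficient : ℕ → ℕ → ℕ → Bool → Set
Sufficient n r s plus = 1 ≤ r × 1 ≤ s × n ∸ 2 ≤ r + s × (plus ≡ true ⊎ (2 ≤ r × 2 ≤ s))

n∸2≤1+t⇒n∸3≤t : ∀ n {t} → n ∸ 2 ≤ suc t → n ∸ 3 ≤ t
n∸2≤1+t⇒n∸3≤t n n∸2≤1+t = ≤-trans (≤-reflexive (sym (∸-+-assoc n 2 1))) (∸-monoˡ-≤ 1 n∸2≤1+t)

n∸2≤1+[n∸3] : ∀ n → n ∸ 2 ≤ suc (n ∸ 3)
n∸2≤1+[n∸3] n = ≤-trans (m≤n+m∸n (n ∸ 2) 1) (≤-reflexive (cong suc (∸-+-assoc n 2 1)))

admissible⇒sufficient : ∀ {n r s plus} → 4 ≤ n → Admissible n r s plus → Sufficient n r s plus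
admissible⇒sufficient {n} 4≤n (inj₁ (inj₁ (refl , refl , plus≡true))) =
  ≤-refl , ∸-monoˡ-≤ 3 4≤n , n∸2≤1+[n∸3] n , inj₁ plus≡true
admissible⇒sufficient {n} 4≤n (inj₁ (inj₂ (refl , refl , plus≡true))) =
  ∸-monoˡ-≤ 3 4≤n , ≤-refl , ≤-trans (n∸2≤1+[n∸3] n) (≤-reflexive (+-comm 1 (n ∸ 3))) , inj₁ plus≡true
admissible⇒sufficient _ (inj₂ (2≤r , 2≤s , n∸2≤r+s)) =
  ≤-trans (s≤s z≤n) 2≤r , ≤-trans (s≤s z≤n) 2≤s , n∸2≤r+s , inj₂ (2≤r , 2≤s)

necessary⇒admissible : ∀ {n r s plus} → r + 3 ≤ n → s + 3 ≤ n → 1 ≤ r → 1 ≤ s → n ∸ 2 ≤ r + s →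
  (r ≡ 1 → plus ≡ true) → (s ≡ 1 → plus ≡ true) → Admissible n r s plus
necessary⇒admissible {n} {r} {s} r+3≤n s+3≤n 1≤r 1≤s n∸2≤r+s r≡1⇒plus s≡1⇒plus with r ≟ 1 | s ≟ 1
... | yes refl | _ =
  inj₁ (inj₁ (refl , ≤-antisym (m+n≤o⇒m≤o∸n s s+3≤n) (n∸2≤1+t⇒n∸3≤t n n∸2≤r+s) , r≡1⇒plus refl))
... | no _ | yes refl =
  inj₁ (inj₂ (refl , ≤-antisym (m+n≤o⇒m≤o∸n r r+3≤n) n∸3≤r , s≡1⇒plus refl))
  where
  n∸3≤r : n ∸ 3 ≤ r
  n∸3≤r = n∸2≤1+t⇒n∸3≤t n (≤-trans n∸2≤r+s (≤-reflexive (+-comm r 1)))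
... | no r≢1 | no s≢1 = inj₂ (≤∧≢⇒< 1≤r (≢-sym r≢1) , ≤∧≢⇒< 1≤s (≢-sym s≢1) , n∸2≤r+s)

module Graph (n r s : ℕ) (plus : Bool) (4≤n : 4 ≤ n) (r+3≤n : r + 3 ≤ n) (s+3≤n : s + 3 ≤ n) where

  infix 4 _—_
  _—_ : ℕ → ℕ → Set
  i — j = GEdge n r s plus i j ⊎ GEdge n r s plus j i

  Vertex : ℕ → Set
  Vertex k = 1 ≤ k × k ≤ n

  Avoids : ℕ → ℕ → ℕ → Set
  Avoids a b k = k ≢ a × k ≢ b

  Walk : ℕ → ℕ → ℕ → ℕ → Set
  Walk a b = Star (λ i j → i — j × Avoids a b i × Avoids a b j)

  ConnectedWithout : ℕ → ℕ → Set
  ConnectedWithout a b = ∀ {i j} → Vertex i → Vertex j → Avoids a b i → Avoids a b j → Walk a b i j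

  1≤n : 1 ≤ n
  1≤n = ≤-trans (s≤s z≤n) 4≤n

  2≤n : 2 ≤ n
  2≤n = ≤-trans (s≤s (s≤s z≤n)) 4≤n

  3≤n : 3 ≤ n
  3≤n = ≤-trans (n≤1+n 3) 4≤n

  n≢1 : n ≢ 1
  n≢1 refl = contradiction 4≤n λ { (s≤s ()) }

  r<n : r < n
  r<n = <-≤-trans (m<m+n r (s≤s z≤n)) r+3≤n

  s+2<n : suc (suc s) < n
  s+2<n = ≤-trans (≤-reflexive (+-comm 3 s)) s+3≤n

  n∸t<n : ∀ {t} → 1 ≤ t → t ≤ n → n ∸ t < n
  n∸t<n 1≤t t≤n = ∸-monoʳ-< 1≤t t≤n

  3≤n∸r : 3 ≤ n ∸ r
  3≤n∸r = m+n≤o⇒m≤o∸n 3 (subst (_≤ n) (+-comm r 3) r+3≤n)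

  3≤n∸1 : 3 ≤ n ∸ 1
  3≤n∸1 = ∸-monoˡ-≤ 1 4≤n

  Vertex-1 : Vertex 1
  Vertex-1 = ≤-refl , 1≤n

  Vertex-2 : Vertex 2
  Vertex-2 = s≤s z≤n , 2≤n

  Vertex-n : Vertex n
  Vertex-n = 1≤n , ≤-refl

  Vertex-n∸ : ∀ t → t < n → Vertex (n ∸ t)
  Vertex-n∸ t t<n = m<n⇒0<n∸m t<n , m∸n≤m n t

  edge-endpoints : ∀ {i j} → GEdge n r s plus i j → Vertex i × Vertex j
  edge-endpoints (spine 1≤i i<n)    = (1≤i , <⇒≤ i<n) , (s≤s z≤n , i<n)
  edge-endpoints (left {t} _ t≤r)   = Vertex-1 , Vertex-n∸ t (≤-<-trans t≤r r<n)
  edge-endpoints (right _ t≤s)      = Vertex-n , (s≤s z≤n , ≤-trans (s≤s (m≤n⇒m≤1+n t≤s)) (<⇒≤ s+2<n))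
  edge-endpoints (plusE _)          = Vertex-1 , Vertex-n

  —-endpoints : ∀ {i j} → i — j → Vertex i × Vertex j
  —-endpoints (inj₁ e) = edge-endpoints e
  —-endpoints (inj₂ e) = let vj , vi = edge-endpoints e in vi , vj

  —-sym : ∀ {i j} → i — j → j — i
  —-sym = swap

  spine-edge : ∀ {i} → 1 ≤ i → i < n → i — suc i
  spine-edge 1≤i i<n = inj₁ (spine 1≤i i<n)

  n∸1—n : n ∸ 1 — n
  n∸1—n = subst (n ∸ 1 —_) (m+[n∸m]≡n 1≤n) (spine-edge (≤-trans (s≤s z≤n) 3≤n∸1) (n∸t<n ≤-refl 1≤n))

  left-edge : ∀ {k} → n ∸ r ≤ k → k < n → k — 1
  left-edge {k} n∸r≤k k<n = inj₂ (subst (GEdge n r s plus 1) (m∸[m∸n]≡n (<⇒≤ k<n))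
    (left (m<n⇒0<n∸m k<n) (subst (n ∸ k ≤_) (m∸[m∸n]≡n (<⇒≤ r<n)) (∸-monoʳ-≤ n n∸r≤k))))

  right-edge : ∀ {k} → 2 ≤ k → k ≤ suc s → k — n
  right-edge {suc t} (s≤s 1≤t) (s≤s t≤s) = inj₂ (right 1≤t t≤s)

  Avoids? : ∀ a b k → Dec (Avoids a b k)
  Avoids? a b k = ¬? (k ≟ a) ×-dec ¬? (k ≟ b)

  Avoids-swap : ∀ {a b k} → Avoids a b k → Avoids b a k
  Avoids-swap (k≢a , k≢b) = k≢b , k≢a

  removed : ∀ {a b k} → ¬ Avoids a b k → k ≡ a ⊎ k ≡ b
  removed {a} {b} {k} k∈ with k ≟ a | k ≟ b
  ... | yes k≡a | _       = inj₁ k≡a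
  ... | no _    | yes k≡b = inj₂ k≡b
  ... | no k≢a  | no k≢b  = contradiction (k≢a , k≢b) k∈

  avoids-third : ∀ {a b x y k} → ¬ Avoids a b x → ¬ Avoids a b y → x ≢ y → k ≢ x → k ≢ y → Avoids a b k
  avoids-third x∈ y∈ x≢y k≢x k≢y with removed x∈ | removed y∈
  ... | inj₁ refl | inj₁ refl = contradiction refl x≢y
  ... | inj₁ refl | inj₂ refl = k≢x , k≢y
  ... | inj₂ refl | inj₁ refl = k≢y , k≢x
  ... | inj₂ refl | inj₂ refl = contradiction refl x≢y

  walk-reverse : ∀ {a b i j} → Walk a b i j → Walk a b j i
  walk-reverse = reverse λ (e , avi , avj) → —-sym e , avj , avi

  walk-swap : ∀ {a b i j} → Walk a b i j → Walk b a i j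
  walk-swap = Star.map λ (e , avi , avj) → e , Avoids-swap avi , Avoids-swap avj

  spine-walk : ∀ {a b p q} → p ≤ q → 1 ≤ p → q ≤ n → (∀ {k} → p ≤ k → k ≤ q → Avoids a b k) → Walk a b p q
  spine-walk = go ∘ ≤⇒≤′
    where
    go : ∀ {a b p q} → p ≤′ q → 1 ≤ p → q ≤ n → (∀ {k} → p ≤ k → k ≤ q → Avoids a b k) → Walk a b p q
    go ≤′-refl _ _ _ = ε
    go {p = p} (≤′-step {q} p≤′q) 1≤p q<n free =
      go p≤′q 1≤p (<⇒≤ q<n) (λ p≤k k≤q → free p≤k (m≤n⇒m≤1+n k≤q))
      ◅◅ (spine-edge (≤-trans 1≤p p≤q) q<n , free p≤q (n≤1+n _) , free (m≤n⇒m≤1+n p≤q) ≤-refl) ◅ ε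
      where
      p≤q : p ≤ q
      p≤q = ≤′⇒≤ p≤′q

  Hub : ℕ → ℕ → ℕ → Set
  Hub a b h = ∀ {k} → Vertex k → Avoids a b k → Walk a b k h

  Hub-swap : ∀ {a b h} → Hub a b h → Hub b a h
  Hub-swap hub vk avk = walk-swap (hub vk (Avoids-swap avk))

  hub-2 : ∀ {a b} → ¬ Avoids a b 1 → ¬ Avoids a b n → Hub a b 2
  hub-2 {a} {b} 1∈ n∈ {k} (1≤k , k≤n) avk =
    walk-reverse (spine-walk 2≤k (s≤s z≤n) k≤n λ 2≤k′ k′≤k →
      avoids-third 1∈ n∈ (≢-sym n≢1) (>⇒≢ 2≤k′) (<⇒≢ (≤-<-trans k′≤k k<n)))
    where
    2≤k : 2 ≤ k
    2≤k = ≤∧≢⇒< 1≤k λ 1≡k → 1∈ (subst (Avoids a b) (sym 1≡k) avk)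
    k<n : k < n
    k<n = ≤∧≢⇒< k≤n λ k≡n → n∈ (subst (Avoids a b) k≡n avk)

  hub-n : ∀ {x} → 1 ≤ s → x ≢ n → Hub 1 x n
  hub-n {x} 1≤s x≢n {k} (1≤k , k≤n) avk@(k≢1 , k≢x) with k ≤? suc s | x <? k
  ... | yes k≤s+1 | _ = (right-edge (≤∧≢⇒< 1≤k (≢-sym k≢1)) k≤s+1 , avk , n≢1 , ≢-sym x≢n) ◅ ε
  ... | no _ | yes x<k =
    spine-walk k≤n 1≤k ≤-refl λ k≤k′ _ →
      >⇒≢ (≤-trans (≤∧≢⇒< 1≤k (≢-sym k≢1)) k≤k′) , >⇒≢ (<-≤-trans x<k k≤k′)
  ... | no s+1≮k | no x≮k =
    walk-reverse (spine-walk s+1≤k (s≤s z≤n) k≤n λ s+1≤k′ k′≤k →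
      >⇒≢ (≤-trans (s≤s 1≤s) s+1≤k′) , <⇒≢ (≤-<-trans k′≤k k<x))
    ◅◅ (right-edge (s≤s 1≤s) ≤-refl , (>⇒≢ (s≤s 1≤s) , <⇒≢ (≤-<-trans s+1≤k k<x)) , n≢1 , ≢-sym x≢n) ◅ ε
    where
    s+1≤k : suc s ≤ k
    s+1≤k = <⇒≤ (≰⇒> s+1≮k)
    k<x : k < x
    k<x = ≤∧≢⇒< (≮⇒≥ x≮k) k≢x

  hub-1 : ∀ {x} → 1 ≤ r → x ≢ 1 → Hub x n 1
  hub-1 {x} 1≤r x≢1 {k} (1≤k , k≤n) avk@(k≢x , k≢n) with n ∸ r ≤? k | x <? k
  ... | yes n∸r≤k | _ = (left-edge n∸r≤k (≤∧≢⇒< k≤n k≢n) , avk , ≢-sym x≢1 , ≢-sym n≢1) ◅ ε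
  ... | no n∸r≰k | yes x<k =
    spine-walk k≤n∸r 1≤k (<⇒≤ n∸r<n) (λ k≤k′ k′≤n∸r →
      >⇒≢ (<-≤-trans x<k k≤k′) , <⇒≢ (≤-<-trans k′≤n∸r n∸r<n))
    ◅◅ (left-edge ≤-refl n∸r<n , (>⇒≢ (<-≤-trans x<k k≤n∸r) , <⇒≢ n∸r<n) , ≢-sym x≢1 , ≢-sym n≢1) ◅ ε
    where
    n∸r<n : n ∸ r < n
    n∸r<n = n∸t<n 1≤r (<⇒≤ r<n)
    k≤n∸r : k ≤ n ∸ r
    k≤n∸r = <⇒≤ (≰⇒> n∸r≰k)
  ... | no _ | no x≮k =
    walk-reverse (spine-walk 1≤k ≤-refl k≤n λ _ k′≤k →
      <⇒≢ (≤-<-trans k′≤k (≤∧≢⇒< (≮⇒≥ x≮k) k≢x)) , <⇒≢ (≤-<-trans k′≤k (≤∧≢⇒< k≤n k≢n)))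

  hub-1-via-n : ∀ {a b} → (∀ k → n ∸ r ≤ k ⊎ k ≤ suc s) →
    Avoids a b 1 → Avoids a b n → Walk a b n 1 → Hub a b 1
  hub-1-via-n covered av1 avn n⇝1 {k} (1≤k , k≤n) avk with k ≟ 1 | k ≟ n | covered k
  ... | yes refl | _        | _          = ε
  ... | no _     | yes refl | _          = n⇝1
  ... | no _     | no k≢n   | inj₁ n∸r≤k = (left-edge n∸r≤k (≤∧≢⇒< k≤n k≢n) , avk , av1) ◅ ε
  ... | no k≢1   | no _     | inj₂ k≤s+1 = (right-edge (≤∧≢⇒< 1≤k (≢-sym k≢1)) k≤s+1 , avk , avn) ◅ n⇝1

  walk-n-1 : ∀ {a b} → plus ≡ true ⊎ (2 ≤ r × 2 ≤ s) → Avoids a b 1 → Avoids a b n → Walk a b n 1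
  walk-n-1 (inj₁ plus≡true) av1 avn = (inj₂ (plusE plus≡true) , avn , av1) ◅ ε
  walk-n-1 {a} {b} (inj₂ (2≤r , 2≤s)) av1 avn with Avoids? a b 2 | Avoids? a b (n ∸ 1)
  ... | yes av2 | _ =
    (—-sym (right-edge ≤-refl (m≤n⇒m≤1+n 2≤s)) , avn , av2)
    ◅ (—-sym (spine-edge ≤-refl 2≤n) , av2 , av1) ◅ ε
  ... | no _ | yes avn∸1 =
    (—-sym n∸1—n , avn , avn∸1)
    ◅ (left-edge (∸-monoʳ-≤ n (≤-trans (s≤s z≤n) 2≤r)) (n∸t<n ≤-refl 1≤n) , avn∸1 , av1) ◅ ε
  ... | no 2∈ | no n∸1∈ =
    (—-sym (right-edge (s≤s (s≤s z≤n)) (s≤s 2≤s)) , avn , middle ≤-refl 3≤n∸2)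
    ◅ spine-walk 3≤n∸2 (s≤s z≤n) (m∸n≤m n 2) middle
    ◅◅ (left-edge (∸-monoʳ-≤ n 2≤r) (n∸t<n (s≤s z≤n) 2≤n) , middle 3≤n∸2 ≤-refl , av1) ◅ ε
    where
    3≤n∸2 : 3 ≤ n ∸ 2
    3≤n∸2 = ≤-trans 3≤n∸r (∸-monoʳ-≤ n 2≤r)
    middle : ∀ {k} → 3 ≤ k → k ≤ n ∸ 2 → Avoids a b k
    middle 3≤k k≤n∸2 = avoids-third 2∈ n∸1∈ (<⇒≢ 3≤n∸1) (>⇒≢ 3≤k)
      (<⇒≢ (≤-<-trans k≤n∸2 (∸-monoʳ-< ≤-refl 2≤n)))

  covered : n ∸ 2 ≤ r + s → ∀ k → n ∸ r ≤ k ⊎ k ≤ suc s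
  covered n∸2≤r+s k with n ∸ r ≤? k
  ... | yes n∸r≤k = inj₁ n∸r≤k
  ... | no n∸r≰k = inj₂ (≤-pred (begin-strict
    k                <⟨ ≰⇒> n∸r≰k ⟩
    n ∸ r            ≤⟨ ∸-monoˡ-≤ r (≤-trans (m≤n+m∸n n 2) (+-monoʳ-≤ 2 n∸2≤r+s)) ⟩
    2 + (r + s) ∸ r  ≡⟨ cong (_∸ r) (trans (+-suc r (suc s)) (cong suc (+-suc r s))) ⟨
    r + (2 + s) ∸ r  ≡⟨ m+n∸m≡n r (2 + s) ⟩
    2 + s            ∎))
    where open ≤-Reasoning

  hub : Sufficient n r s plus → ∀ a b → Σ[ h ∈ ℕ ] Hub a b h
  hub (1≤r , 1≤s , n∸2≤r+s , n—1) a b with Avoids? a b 1 | Avoids? a b n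
  ... | yes av1 | yes avn = 1 , hub-1-via-n (covered n∸2≤r+s) av1 avn (walk-n-1 n—1 av1 avn)
  ... | no 1∈   | no n∈   = 2 , hub-2 1∈ n∈
  ... | no 1∈   | yes (n≢a , n≢b) with removed 1∈
  ...   | inj₁ refl = n , hub-n 1≤s (≢-sym n≢b)
  ...   | inj₂ refl = n , Hub-swap (hub-n 1≤s (≢-sym n≢a))
  hub (1≤r , _) a b | yes (1≢a , 1≢b) | no n∈ with removed n∈
  ...   | inj₁ refl = 1 , Hub-swap (hub-1 1≤r (≢-sym 1≢b))
  ...   | inj₂ refl = 1 , hub-1 1≤r (≢-sym 1≢a)

  connectedWithout : Sufficient n r s plus → ∀ a b → ConnectedWithout a b
  connectedWithout sufficient a b vi vj avi avj =
    let _ , reaches = hub sufficient a b in reaches vi avi ◅◅ walk-reverse (reaches vj avj)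

  Closed : ℕ → ℕ → (ℕ → Set) → Set
  Closed a b C = ∀ {i j} → i — j → C i → Avoids a b j → C j

  walk-closed : ∀ {a b C i j} → Closed a b C → Walk a b i j → C i → C j
  walk-closed closed ε                   Ci = Ci
  walk-closed closed ((e , _ , avj) ◅ w) Ci = walk-closed closed w (closed e Ci avj)

  closed⇒¬connected : ∀ {a b c d} (C : ℕ → Set) → Closed a b C → C c → ¬ C d →
    Vertex c → Vertex d → Avoids a b c → Avoids a b d → ¬ ConnectedWithout a b
  closed⇒¬connected C closed Cc ¬Cd vc vd avc avd connected =
    ¬Cd (walk-closed closed (connected vc vd avc avd) Cc)

  isolated⇒¬connected : ∀ {a b u v} → (∀ {i j} → i — j → i ≡ u → ¬ Avoids a b j) → u ≢ v →
    Vertex u → Vertex v → Avoids a b u → Avoids a b v → ¬ ConnectedWithout a b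
  isolated⇒¬connected {u = u} isolated u≢v =
    closed⇒¬connected (_≡ u) (λ e i≡u avj → contradiction avj (isolated e i≡u)) refl (u≢v ∘ sym)

  neighbours-of-1 : ∀ {i j} → i — j → i ≡ 1 →
    j ≡ 2 ⊎ (Σ[ t ∈ ℕ ] 1 ≤ t × t ≤ r × j ≡ n ∸ t) ⊎ (plus ≡ true × j ≡ n)
  neighbours-of-1 (inj₁ (spine _ _))        refl  = inj₁ refl
  neighbours-of-1 (inj₁ (left {t} 1≤t t≤r)) _     = inj₂ (inj₁ (t , 1≤t , t≤r , refl))
  neighbours-of-1 (inj₁ (right _ _))        n≡1   = contradiction n≡1 n≢1
  neighbours-of-1 (inj₁ (plusE plus≡true))  _     = inj₂ (inj₂ (plus≡true , refl))
  neighbours-of-1 (inj₂ (spine () _))       refl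
  neighbours-of-1 (inj₂ (left _ t≤r))       n∸t≡1 =
    contradiction (≤-trans 3≤n∸r (≤-trans (∸-monoʳ-≤ n t≤r) (≤-reflexive n∸t≡1))) λ { (s≤s ()) }
  neighbours-of-1 (inj₂ (right () _))       refl
  neighbours-of-1 (inj₂ (plusE _))          n≡1   = contradiction n≡1 n≢1

  neighbours-of-n : ∀ {i j} → i — j → i ≡ n →
    suc j ≡ n ⊎ (Σ[ t ∈ ℕ ] 1 ≤ t × t ≤ s × j ≡ suc t) ⊎ (plus ≡ true × j ≡ 1)
  neighbours-of-n (inj₁ (spine _ i<n))       refl  = contradiction i<n (n≮n n)
  neighbours-of-n (inj₁ (left _ _))          1≡n   = contradiction (sym 1≡n) n≢1
  neighbours-of-n (inj₁ (right {t} 1≤t t≤s)) _     = inj₂ (inj₁ (t , 1≤t , t≤s , refl))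
  neighbours-of-n (inj₁ (plusE _))           1≡n   = contradiction (sym 1≡n) n≢1
  neighbours-of-n (inj₂ (spine _ _))         j+1≡n = inj₁ j+1≡n
  neighbours-of-n (inj₂ (left 1≤t t≤r))      n∸t≡n =
    contradiction n∸t≡n (<⇒≢ (n∸t<n 1≤t (<⇒≤ (≤-<-trans t≤r r<n))))
  neighbours-of-n (inj₂ (right _ t≤s))       t+1≡n =
    contradiction t+1≡n (<⇒≢ (≤-trans (s≤s (s≤s t≤s)) (<⇒≤ s+2<n)))
  neighbours-of-n (inj₂ (plusE plus≡true))   _     = inj₂ (inj₂ (plus≡true , refl))

  neighbours-inside : ∀ {i j} → i — j → suc (suc s) ≤ i → i < n ∸ r → j ≡ suc i ⊎ suc j ≡ i
  neighbours-inside (inj₁ (spine _ _))   _            _       = inj₁ refl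
  neighbours-inside (inj₁ (left _ _))    (s≤s ())     _
  neighbours-inside (inj₁ (right _ _))   _            n<n∸r   = contradiction (<-≤-trans n<n∸r (m∸n≤m n r)) (n≮n n)
  neighbours-inside (inj₁ (plusE _))     (s≤s ())     _
  neighbours-inside (inj₂ (spine _ _))   _            _       = inj₂ refl
  neighbours-inside (inj₂ (left _ t≤r))  _            n∸t<n∸r = contradiction (<-≤-trans n∸t<n∸r (∸-monoʳ-≤ n t≤r)) (n≮n _)
  neighbours-inside (inj₂ (right _ t≤s)) (s≤s s+1≤t) _        = contradiction (≤-trans s+1≤t t≤s) (n≮n s)
  neighbours-inside (inj₂ (plusE _))     _            n<n∸r   = contradiction (<-≤-trans n<n∸r (m∸n≤m n r)) (n≮n n)

  r≡0⇒¬connected : r ≡ 0 → ¬ ConnectedWithout 2 n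
  r≡0⇒¬connected refl = isolated⇒¬connected isolated (λ ())
    Vertex-1 (s≤s z≤n , 3≤n) ((λ ()) , <⇒≢ 2≤n) ((λ ()) , <⇒≢ 4≤n)
    where
    isolated : ∀ {i j} → i — j → i ≡ 1 → ¬ Avoids 2 n j
    isolated e i≡1 (j≢2 , j≢n) with neighbours-of-1 e i≡1
    ... | inj₁ j≡2                        = j≢2 j≡2
    ... | inj₂ (inj₁ (_ , 1≤t , t≤0 , _)) = contradiction (≤-trans 1≤t t≤0) λ ()
    ... | inj₂ (inj₂ (_ , j≡n))           = j≢n j≡n

  s≡0⇒¬connected : s ≡ 0 → ¬ ConnectedWithout 1 (n ∸ 1)
  s≡0⇒¬connected refl = isolated⇒¬connected isolated (≢-sym (<⇒≢ 3≤n))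
    Vertex-n Vertex-2 (n≢1 , ≢-sym (<⇒≢ (n∸t<n ≤-refl 1≤n))) ((λ ()) , <⇒≢ 3≤n∸1)
    where
    isolated : ∀ {i j} → i — j → i ≡ n → ¬ Avoids 1 (n ∸ 1) j
    isolated e i≡n (j≢1 , j≢n∸1) with neighbours-of-n e i≡n
    ... | inj₁ j+1≡n                      = j≢n∸1 (cong (_∸ 1) j+1≡n)
    ... | inj₂ (inj₁ (_ , 1≤t , t≤0 , _)) = contradiction (≤-trans 1≤t t≤0) λ ()
    ... | inj₂ (inj₂ (_ , j≡1))           = j≢1 j≡1

  r≡1⇒¬connected : r ≡ 1 → plus ≢ true → ¬ ConnectedWithout 2 (n ∸ 1)
  r≡1⇒¬connected refl plus≢true = isolated⇒¬connected isolated (≢-sym n≢1)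
    Vertex-1 Vertex-n ((λ ()) , <⇒≢ (≤-trans (s≤s (s≤s z≤n)) 3≤n∸1))
    (≢-sym (<⇒≢ 3≤n) , ≢-sym (<⇒≢ (n∸t<n ≤-refl 1≤n)))
    where
    isolated : ∀ {i j} → i — j → i ≡ 1 → ¬ Avoids 2 (n ∸ 1) j
    isolated e i≡1 (j≢2 , j≢n∸1) with neighbours-of-1 e i≡1
    ... | inj₁ j≡2                            = j≢2 j≡2
    ... | inj₂ (inj₁ (_ , 1≤t , t≤1 , j≡n∸t)) = j≢n∸1 (trans j≡n∸t (cong (n ∸_) (≤-antisym t≤1 1≤t)))
    ... | inj₂ (inj₂ (plus≡true , _))         = plus≢true plus≡true

  s≡1⇒¬connected : s ≡ 1 → plus ≢ true → ¬ ConnectedWithout (n ∸ 1) 2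
  s≡1⇒¬connected refl plus≢true = isolated⇒¬connected isolated n≢1
    Vertex-n Vertex-1 (≢-sym (<⇒≢ (n∸t<n ≤-refl 1≤n)) , ≢-sym (<⇒≢ 3≤n))
    (<⇒≢ (≤-trans (s≤s (s≤s z≤n)) 3≤n∸1) , (λ ()))
    where
    isolated : ∀ {i j} → i — j → i ≡ n → ¬ Avoids (n ∸ 1) 2 j
    isolated e i≡n (j≢n∸1 , j≢2) with neighbours-of-n e i≡n
    ... | inj₁ j+1≡n                          = j≢n∸1 (cong (_∸ 1) j+1≡n)
    ... | inj₂ (inj₁ (_ , 1≤t , t≤1 , j≡t+1)) = j≢2 (trans j≡t+1 (cong suc (≤-antisym t≤1 1≤t)))
    ... | inj₂ (inj₂ (plus≡true , _))         = plus≢true plus≡true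

  sparse⇒¬connected : 1 ≤ s → suc (suc s) < n ∸ r → ¬ ConnectedWithout (suc s) (n ∸ r)
  sparse⇒¬connected 1≤s s+2<n∸r = closed⇒¬connected Inside closed (≤-refl , s+2<n∸r) (λ { (s≤s () , _) })
    (s≤s z≤n , <⇒≤ s+2<n) Vertex-1 (≢-sym (<⇒≢ (n<1+n (suc s))) , <⇒≢ s+2<n∸r)
    (<⇒≢ (s≤s 1≤s) , <⇒≢ (≤-trans (s≤s (s≤s z≤n)) 3≤n∸r))
    where
    Inside : ℕ → Set
    Inside k = suc (suc s) ≤ k × k < n ∸ r
    closed : Closed (suc s) (n ∸ r) Inside
    closed e (s+2≤i , i<n∸r) (j≢s+1 , j≢n∸r) with neighbours-inside e s+2≤i i<n∸r
    ... | inj₁ refl = m≤n⇒m≤1+n s+2≤i , ≤∧≢⇒< i<n∸r j≢n∸r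
    ... | inj₂ refl = ≤∧≢⇒< (≤-pred s+2≤i) (≢-sym j≢s+1) , <⇒≤ i<n∸r

  s+2<n∸r : r + s < n ∸ 2 → suc (suc s) < n ∸ r
  s+2<n∸r r+s<n∸2 = m+n≤o⇒m≤o∸n (3 + s) (begin
    3 + s + r        ≡⟨ cong (3 +_) (+-comm s r) ⟩
    3 + (r + s)      ≡⟨ +-comm (suc (r + s)) 2 ⟨
    suc (r + s) + 2  ≤⟨ m≤o∸n⇒m+n≤o (suc (r + s)) 2≤n r+s<n∸2 ⟩
    n                ∎)
    where open ≤-Reasoning

  instance
    n-nonZero : NonZero n
    n-nonZero = >-nonZero 1≤n

  lab : Fin n → ℕ
  lab z = suc (toℕ z)

  -- Inverse of lab on the labels 1, ..., n; its other values are irrelevant.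
  vertex : ℕ → Fin n
  vertex k = (k ∸ 1) mod n

  lab-vertex : ∀ {k} → Vertex k → lab (vertex k) ≡ k
  lab-vertex {k} (1≤k , k≤n) = begin
    suc (toℕ ((k ∸ 1) mod n)) ≡⟨ cong suc (toℕ-fromℕ< _) ⟩
    suc ((k ∸ 1) % n)         ≡⟨ cong suc (m<n⇒m%n≡m (≤-trans (≤-reflexive (m+[n∸m]≡n 1≤k)) k≤n)) ⟩
    suc (k ∸ 1)               ≡⟨ m+[n∸m]≡n 1≤k ⟩
    k                         ∎
    where open ≡-Reasoning

  vertex-lab : ∀ z → vertex (lab z) ≡ z
  vertex-lab z = toℕ-injective (trans (toℕ-fromℕ< _) (m<n⇒m%n≡m (toℕ<n z)))

  lab-Vertex : ∀ z → Vertex (lab z)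
  lab-Vertex z = s≤s z≤n , toℕ<n z

  -- 0 labels no vertex, so avoiding it is no constraint.
  label : Maybe (Fin n) → ℕ
  label = maybe′ lab 0

  ∈⁅x⁆′⇔ : ∀ {z} x → z ∈ ⁅ x ⁆′ ⇔ lab z ≡ label x
  ∈⁅x⁆′⇔ (just x) = mk⇔ (λ z∈ → cong lab (x∈⁅y⁆⇒x≡y x z∈))
                         (λ e → subst (_∈ ⁅ x ⁆) (sym (toℕ-injective (suc-injective e))) (x∈⁅x⁆ x))
  ∈⁅x⁆′⇔ nothing  = mk⇔ (λ z∈ → contradiction z∈ ∉⊥) λ ()

  ∉⇒Avoids : ∀ {z} x y → z ∉ ⁅ x ⁆′ ∪ ⁅ y ⁆′ → Avoids (label x) (label y) (lab z)
  ∉⇒Avoids x y z∉ = (λ e → z∉ (x∈p∪q⁺ (inj₁ (Equivalence.from (∈⁅x⁆′⇔ x) e))))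
                  , (λ e → z∉ (x∈p∪q⁺ (inj₂ (Equivalence.from (∈⁅x⁆′⇔ y) e))))

  Avoids⇒∉ : ∀ {z} x y → Avoids (label x) (label y) (lab z) → z ∉ ⁅ x ⁆′ ∪ ⁅ y ⁆′
  Avoids⇒∉ x y (≢x , ≢y) z∈ =
    [ ≢x ∘ Equivalence.to (∈⁅x⁆′⇔ x) , ≢y ∘ Equivalence.to (∈⁅x⁆′⇔ y) ]′ (x∈p∪q⁻ _ _ z∈)

  avoids-vertex : ∀ {a b k} → Vertex k → Avoids a b k → Avoids a b (lab (vertex k))
  avoids-vertex {a} {b} vk = subst (Avoids a b) (sym (lab-vertex vk))

  connectedAvoiding⇔ : ∀ x y →
    ConnectedAvoiding (Adj n r s plus) (⁅ x ⁆′ ∪ ⁅ y ⁆′) ⇔ ConnectedWithout (label x) (label y)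
  connectedAvoiding⇔ x y = mk⇔
    (λ connected {i} {j} vi vj avi avj →
      subst₂ (Walk (label x) (label y)) (lab-vertex vi) (lab-vertex vj)
        (Star.gmap lab (λ (e , u∉ , v∉) → e , ∉⇒Avoids x y u∉ , ∉⇒Avoids x y v∉)
          (connected (vertex i) (vertex j)
            (Avoids⇒∉ x y (avoids-vertex vi avi)) (Avoids⇒∉ x y (avoids-vertex vj avj)))))
    (λ connected u v u∉ v∉ →
      subst₂ (Star _) (vertex-lab u) (vertex-lab v)
        (Star.gmap vertex lift-step
          (connected (lab-Vertex u) (lab-Vertex v) (∉⇒Avoids x y u∉) (∉⇒Avoids x y v∉))))
    where
    lift-step : ∀ {i j} → i — j × Avoids (label x) (label y) i × Avoids (label x) (label y) j →
      Adj n r s plus (vertex i) (vertex j) × vertex i ∉ ⁅ x ⁆′ ∪ ⁅ y ⁆′ × vertex j ∉ ⁅ x ⁆′ ∪ ⁅ y ⁆′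
    lift-step (e , avi , avj) =
      let vi , vj = —-endpoints e in
      subst₂ _—_ (sym (lab-vertex vi)) (sym (lab-vertex vj)) e ,
      Avoids⇒∉ x y (avoids-vertex vi avi) , Avoids⇒∉ x y (avoids-vertex vj avj)

  connectedWithout⇒KConnected : (∀ a b → ConnectedWithout a b) → KConnected 3 (Adj n r s plus)
  connectedWithout⇒KConnected connected = Equivalence.from (KConnected3⇔ _)
    (4≤n , λ x y → Equivalence.from (connectedAvoiding⇔ x y) (connected (label x) (label y)))

  module Necessity (3-connected : KConnected 3 (Adj n r s plus)) where

    connected : ∀ {a b} → Vertex a → Vertex b → ConnectedWithout a b
    connected {a} {b} va vb =
      subst₂ ConnectedWithout (lab-vertex va) (lab-vertex vb)
        (Equivalence.to (connectedAvoiding⇔ (just (vertex a)) (just (vertex b)))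
          (proj₂ (Equivalence.to (KConnected3⇔ _) 3-connected) _ _))

    1≤r : 1 ≤ r
    1≤r = n≢0⇒n>0 λ r≡0 → r≡0⇒¬connected r≡0 (connected Vertex-2 Vertex-n)

    1≤s : 1 ≤ s
    1≤s = n≢0⇒n>0 λ s≡0 → s≡0⇒¬connected s≡0 (connected Vertex-1 (Vertex-n∸ 1 2≤n))

    r≡1⇒plus : r ≡ 1 → plus ≡ true
    r≡1⇒plus r≡1 = decidable-stable (plus Bool.≟ true) λ plus≢true →
      r≡1⇒¬connected r≡1 plus≢true (connected Vertex-2 (Vertex-n∸ 1 2≤n))

    s≡1⇒plus : s ≡ 1 → plus ≡ true
    s≡1⇒plus s≡1 = decidable-stable (plus Bool.≟ true) λ plus≢true →
      s≡1⇒¬connected s≡1 plus≢true (connected (Vertex-n∸ 1 2≤n) Vertex-2)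

    n∸2≤r+s : n ∸ 2 ≤ r + s
    n∸2≤r+s = decidable-stable (n ∸ 2 ≤? r + s) λ n∸2≰r+s →
      sparse⇒¬connected 1≤s (s+2<n∸r (≰⇒> n∸2≰r+s))
        (connected (s≤s z≤n , ≤-trans (n≤1+n (suc s)) (<⇒≤ s+2<n)) (Vertex-n∸ r r<n))

    admissible : Admissible n r s plus
    admissible = necessary⇒admissible r+3≤n s+3≤n 1≤r 1≤s n∸2≤r+s r≡1⇒plus s≡1⇒plus

lemma2p1 : (n r s : ℕ) (plus : Bool) → 4 ≤ n → r + 3 ≤ n → s + 3 ≤ n →
    KConnected 3 (Adj n r s plus) ⇔
      (((r ≡ 1 × s ≡ n ∸ 3 × plus ≡ true) ⊎ (s ≡ 1 × r ≡ n ∸ 3 × plus ≡ true))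
        ⊎ (2 ≤ r × 2 ≤ s × n ∸ 2 ≤ r + s))
lemma2p1 n r s plus 4≤n r+3≤n s+3≤n = mk⇔
  Necessity.admissible
  (connectedWithout⇒KConnected ∘ connectedWithout ∘ admissible⇒sufficient 4≤n)
  where open Graph n r s plus 4≤n r+3≤n s+3≤n
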